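{- Let $\mathcal S$ be a model of $\mathsf T_{\Pi,\mathbf B}$, $F:\mathcal C\to\mathcal S$ a functor, $\mathcal S^{\bullet}$ a displayed model without context extensions over $F$, $(\mathcal P,Y,G,\mathcal S^{\dagger})$ a factorization of $\mathcal S^{\bullet}$ and $(S_0,\theta)$ a section of $\mathcal S^{\dagger}$. If $\mathcal C$ has a terminal object that is preserved by $F$, then the displayed inserter $\mathcal I(\mathcal S^{\bullet})$ has a terminal object that is preserved by the projection $I:\mathcal I(\mathcal S^{\bullet})\to\mathcal C$.
   Context: Models. A model of $\mathsf{T}_{\Pi,\mathbf{B}}$ is a category $\mathcal{S}$ with a terminal object, a presheaf $\mathsf{Ty}$ and a locally representable dependent presheaf $\mathsf{Tm}$ over $\mathsf{Ty}$ (context extensions $\Gamma\rhd A$), with substitution-stable $\Pi$-types (with $\mathsf{app}$ a bijection $\mathsf{Tm}(\Gamma,\Pi(A,B))\cong\mathsf{Tm}(\Gamma\rhd A,B)$) and booleans $\mathbf B,\mathsf{true},\mathsf{false},\mathsf{elim}$ with $\beta$-rules. Displayed model without context extensions over $F:\mathcal{C}\to\mathcal{S}$: sets $\mathsf{Ty}^{\bullet}_{\Gamma}(A)$ for $A\in\mathsf{Ty}^{\mathcal S}(F\Gamma)$ and $\mathsf{Tm}^{\bullet}_{\Gamma}(A^{\bullet},a)$ for $a\in\mathsf{Tm}^{\mathcal S}(F\Gamma,A)$, with functorial restriction along morphisms of $\mathcal C$ lying over restriction along their images under $F$, and restriction-stable displayed operations $\Pi^{\bullet},\mathsf{app}^{\bullet}$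 (a bijection), $\mathbf{B}^{\bullet},\mathsf{true}^{\bullet},\mathsf{false}^{\bullet},\mathsf{elim}^{\bullet}$ lying over the corresponding operations of $\mathcal S$ and satisfying the displayed $\beta$-rules for $\mathsf{elim}^{\bullet}$. Such a model $\mathcal S^{\dagger}$ over $G:\mathcal P\to\mathcal S$ has context extensions if each $(c,A,A^{\dagger})$ has a universal $(c.A^{\dagger},p,q,q^{\dagger})$ classifying triples (morphism into $c$, term, displayed term) with $\langle Gp,q\rangle:G(c.A^{\dagger})\to Gc\rhd A$ invertible. Factorization of $\mathcal S^{\bullet}$: category $\mathcal P$, functors $Y:\mathcal C\to\mathcal P$, $G:\mathcal P\to\mathcal S$ with $GY=F$, a displayed model with context extensions $\mathcal S^{\dagger}$ over $G$, $Y$ fully faithful with natural bijections $\mathsf{Ty}^{\bullet}_\Gamma(A)\cong\mathsf{Ty}^{\dagger}_{Y\Gamma}(A)$ and $\mathsf{Tm}^{\bullet}_\Gamma(A^{\bullet},a)\cong\mathsf{Tm}^{\dagger}_{Y\Gamma}(\ldots,a)$. Section of $\mathcal S^{\dagger}$: functor $S_0:\mathcal S\to\mathcal P$ with natural iso $\theta:GS_0\cong\mathrm{id}$, preserving the terminal object, with natural actions on types and terms (into displayed types/terms of $\mathcal S^{\dagger}$ at $S_0\Gamma$) preserving context extensions and all operations. Displayed inserter $\mathcal{I}(\mathcal{S}^{\bullet})$: objects are pairs $(\Gamma,\iota)$ with $\Gamma\in\mathcal C$ and $\iota:Y\Gamma\to S_0(F\Gamma)$ in $\mathcal P$ with $G(\iota)=\theta^{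 -1}_{F\Gamma}$; morphisms $(\Delta,\iota')\to(\Gamma,\iota)$ are $\rho:\Delta\to\Gamma$ in $\mathcal C$ with $\iota\circ Y\rho=S_0(F\rho)\circ\iota'$; $I(\Gamma,\iota)=\Gamma$. -}

module Defs where

open import Level using (Level; _⊔_) renaming (suc to lsuc)
open import Relation.Binary.PropositionalEquality
  using (_≡_; refl; sym; trans; cong; cong₂; subst; subst₂; module ≡-Reasoning)
open import Data.Product using (Σ; _,_; proj₁; proj₂; _×_)

record Category (o h : Level) : Set (lsuc (o ⊔ h)) where
  infixr 9 _∘_
  field
    Ob    : Set o
    Hom   : Ob → Ob → Set h
    id    : ∀ {A} → Hom A A
    _∘_   : ∀ {A B C} → Hom B C → Hom A B → Hom A C
    idˡ   : ∀ {A B} (f : Hom A B) → id ∘ f ≡ f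
    idʳ   : ∀ {A B} (f : Hom A B) → f ∘ id ≡ f
    assoc : ∀ {A B C D} (f : Hom C D) (g : Hom B C) (k : Hom A B) →
            (f ∘ g) ∘ k ≡ f ∘ (g ∘ k)

IsTerminal : ∀ {o h} (C : Category o h) → Category.Ob C → Set (o ⊔ h)
IsTerminal C T = ∀ X → Σ (Hom X T) (λ f → ∀ g → g ≡ f)
  where open Category C

Terminal : ∀ {o h} (C : Category o h) → Set (o ⊔ h)
Terminal C = Σ (Category.Ob C) (IsTerminal C)

record Functor {o h o' h'} (C : Category o h) (D : Category o' h')
       : Set (o ⊔ h ⊔ o' ⊔ h') where
  private
    module C = Category C
    module D = Category D
  field
    F₀   : C.Ob → D.Ob
    F₁   : ∀ {A B} → C.Hom A B → D.Hom (F₀ A) (F₀ B)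
    F-id : ∀ {A} → F₁ (C.id {A}) ≡ D.id
    F-∘  : ∀ {A B E} (f : C.Hom B E) (g : C.Hom A B) →
           F₁ (f C.∘ g) ≡ F₁ f D.∘ F₁ g

-- Conventions: the dependent presheaf Tm over Ty is given
-- in "total" form, as a presheaf Tm with a natural projection ty : Tm → Ty
-- (so Tm(Γ,A) = { a : Tm Γ | ty a ≡ A }).  Typing equations are passed as
-- explicit arguments; laws quantify over all such typing proofs.

record Model (o h t : Level) : Set (lsuc (o ⊔ h ⊔ t)) where
  infixl 6 _▹_
  infixl 8 _[_]T _[_]t
  field
    cat : Category o h
  open Category cat public
  field
    ◇          : Ob
    ◇-terminal : IsTerminal cat ◇
    Ty    : Ob → Set t
    _[_]T : ∀ {Γ Δ} → Ty Γ → Hom Δ Γ → Ty Δ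
    [id]T : ∀ {Γ} (A : Ty Γ) → A [ id ]T ≡ A
    [∘]T  : ∀ {Γ Δ Θ} (A : Ty Γ) (σ : Hom Δ Γ) (τ : Hom Θ Δ) →
            A [ σ ∘ τ ]T ≡ A [ σ ]T [ τ ]T
    Tm    : Ob → Set t
    ty    : ∀ {Γ} → Tm Γ → Ty Γ
    _[_]t : ∀ {Γ Δ} → Tm Γ → Hom Δ Γ → Tm Δ
    ty[]  : ∀ {Γ Δ} (a : Tm Γ) (σ : Hom Δ Γ) → ty (a [ σ ]t) ≡ ty a [ σ ]T
    [id]t : ∀ {Γ} (a : Tm Γ) → a [ id ]t ≡ a
    [∘]t  : ∀ {Γ Δ Θ} (a : Tm Γ) (σ : Hom Δ Γ) (τ : Hom Θ Δ) →
            a [ σ ∘ τ ]t ≡ a [ σ ]t [ τ ]t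
    _▹_   : (Γ : Ob) → Ty Γ → Ob
    p     : ∀ {Γ} {A : Ty Γ} → Hom (Γ ▹ A) Γ
    q     : ∀ {Γ} {A : Ty Γ} → Tm (Γ ▹ A)
    ty-q  : ∀ {Γ} (A : Ty Γ) → ty (q {A = A}) ≡ A [ p ]T
    ⟨_,_⟩ : ∀ {Γ Δ} {A : Ty Γ} (σ : Hom Δ Γ) (a : Tm Δ) → ty a ≡ A [ σ ]T →
            Hom Δ (Γ ▹ A)
    p∘⟨⟩  : ∀ {Γ Δ} {A : Ty Γ} (σ : Hom Δ Γ) (a : Tm Δ) (e : ty a ≡ A [ σ ]T) →
            p ∘ ⟨ σ , a ⟩ e ≡ σ
    q[⟨⟩] : ∀ {Γ Δ} {A : Ty Γ} (σ : Hom Δ Γ) (a : Tm Δ) (e : ty a ≡ A [ σ ]T) →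
            q [ ⟨ σ , a ⟩ e ]t ≡ a
    ⟨⟩-unique : ∀ {Γ Δ} {A : Ty Γ} (σ : Hom Δ Γ) (a : Tm Δ) (e : ty a ≡ A [ σ ]T)
            (ρ : Hom Δ (Γ ▹ A)) → p ∘ ρ ≡ σ → q [ ρ ]t ≡ a → ρ ≡ ⟨ σ , a ⟩ e
    Π     : ∀ {Γ} (A : Ty Γ) → Ty (Γ ▹ A) → Ty Γ
    Π[]   : ∀ {Γ Δ} (A : Ty Γ) (B : Ty (Γ ▹ A)) (σ : Hom Δ Γ)
            (e : ty (q {A = A [ σ ]T}) ≡ A [ σ ∘ p ]T) →
            Π A B [ σ ]T ≡ Π (A [ σ ]T) (B [ ⟨ σ ∘ p , q ⟩ e ]T)
    app   : ∀ {Γ} (A : Ty Γ) (B : Ty (Γ ▹ A)) (t : Tm Γ) → ty t ≡ Π A B →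
            Tm (Γ ▹ A)
    ty-app : ∀ {Γ} (A : Ty Γ) (B : Ty (Γ ▹ A)) (t : Tm Γ) (e : ty t ≡ Π A B) →
            ty (app A B t e) ≡ B
    lam   : ∀ {Γ} (A : Ty Γ) (B : Ty (Γ ▹ A)) (b : Tm (Γ ▹ A)) → ty b ≡ B → Tm Γ
    ty-lam : ∀ {Γ} (A : Ty Γ) (B : Ty (Γ ▹ A)) (b : Tm (Γ ▹ A)) (e : ty b ≡ B) →
            ty (lam A B b e) ≡ Π A B
    app-lam : ∀ {Γ} (A : Ty Γ) (B : Ty (Γ ▹ A)) (b : Tm (Γ ▹ A)) (e : ty b ≡ B)
            (e' : ty (lam A B b e) ≡ Π A B) → app A B (lam A B b e) e' ≡ b
    lam-app : ∀ {Γ} (A : Ty Γ) (B : Ty (Γ ▹ A)) (t : Tm Γ) (e : ty t ≡ Π A B)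
            (e' : ty (app A B t e) ≡ B) → lam A B (app A B t e) e' ≡ t
    app[] : ∀ {Γ Δ} (A : Ty Γ) (B : Ty (Γ ▹ A)) (t : Tm Γ) (e : ty t ≡ Π A B)
            (σ : Hom Δ Γ) (e₁ : ty (q {A = A [ σ ]T}) ≡ A [ σ ∘ p ]T)
            (e₂ : ty (t [ σ ]t) ≡ Π (A [ σ ]T) (B [ ⟨ σ ∘ p , q ⟩ e₁ ]T)) →
            app A B t e [ ⟨ σ ∘ p , q ⟩ e₁ ]t
              ≡ app (A [ σ ]T) (B [ ⟨ σ ∘ p , q ⟩ e₁ ]T) (t [ σ ]t) e₂
    𝔹     : ∀ {Γ} → Ty Γ
    𝔹[]   : ∀ {Γ Δ} (σ : Hom Δ Γ) → 𝔹 [ σ ]T ≡ 𝔹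
    true  : ∀ {Γ} → Tm Γ
    false : ∀ {Γ} → Tm Γ
    ty-true  : ∀ {Γ} → ty (true {Γ}) ≡ 𝔹
    ty-false : ∀ {Γ} → ty (false {Γ}) ≡ 𝔹
    true[]  : ∀ {Γ Δ} (σ : Hom Δ Γ) → true [ σ ]t ≡ true
    false[] : ∀ {Γ Δ} (σ : Hom Δ Γ) → false [ σ ]t ≡ false
    elim  : ∀ {Γ} (C : Ty (Γ ▹ 𝔹)) (ct cf b : Tm Γ)
            (e₁ : ty true ≡ 𝔹 [ id ]T) → ty ct ≡ C [ ⟨ id , true ⟩ e₁ ]T →
            (e₂ : ty false ≡ 𝔹 [ id ]T) → ty cf ≡ C [ ⟨ id , false ⟩ e₂ ]T →
            ty b ≡ 𝔹 → Tm Γ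
    ty-elim : ∀ {Γ} (C : Ty (Γ ▹ 𝔹)) (ct cf b : Tm Γ)
            (e₁ : ty true ≡ 𝔹 [ id ]T) (et : ty ct ≡ C [ ⟨ id , true ⟩ e₁ ]T)
            (e₂ : ty false ≡ 𝔹 [ id ]T) (ef : ty cf ≡ C [ ⟨ id , false ⟩ e₂ ]T)
            (eb : ty b ≡ 𝔹) (e₃ : ty b ≡ 𝔹 [ id ]T) →
            ty (elim C ct cf b e₁ et e₂ ef eb) ≡ C [ ⟨ id , b ⟩ e₃ ]T
    elim-true : ∀ {Γ} (C : Ty (Γ ▹ 𝔹)) (ct cf : Tm Γ)
            (e₁ : ty true ≡ 𝔹 [ id ]T) (et : ty ct ≡ C [ ⟨ id , true ⟩ e₁ ]T)
            (e₂ : ty false ≡ 𝔹 [ id ]T) (ef : ty cf ≡ C [ ⟨ id , false ⟩ e₂ ]T)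
            (eb : ty true ≡ 𝔹) →
            elim C ct cf true e₁ et e₂ ef eb ≡ ct
    elim-false : ∀ {Γ} (C : Ty (Γ ▹ 𝔹)) (ct cf : Tm Γ)
            (e₁ : ty true ≡ 𝔹 [ id ]T) (et : ty ct ≡ C [ ⟨ id , true ⟩ e₁ ]T)
            (e₂ : ty false ≡ 𝔹 [ id ]T) (ef : ty cf ≡ C [ ⟨ id , false ⟩ e₂ ]T)
            (eb : ty false ≡ 𝔹) →
            elim C ct cf false e₁ et e₂ ef eb ≡ cf
    elim[] : ∀ {Γ Δ} (C : Ty (Γ ▹ 𝔹)) (ct cf b : Tm Γ)
            (e₁ : ty true ≡ 𝔹 [ id ]T) (et : ty ct ≡ C [ ⟨ id , true ⟩ e₁ ]T)
            (e₂ : ty false ≡ 𝔹 [ id ]T) (ef : ty cf ≡ C [ ⟨ id , false ⟩ e₂ ]T)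
            (eb : ty b ≡ 𝔹) (σ : Hom Δ Γ)
            (e₀ : ty (q {A = 𝔹 {Δ}}) ≡ 𝔹 [ σ ∘ p ]T)
            (e₁' : ty true ≡ 𝔹 [ id ]T)
            (et' : ty (ct [ σ ]t) ≡ C [ ⟨ σ ∘ p , q ⟩ e₀ ]T [ ⟨ id , true ⟩ e₁' ]T)
            (e₂' : ty false ≡ 𝔹 [ id ]T)
            (ef' : ty (cf [ σ ]t) ≡ C [ ⟨ σ ∘ p , q ⟩ e₀ ]T [ ⟨ id , false ⟩ e₂' ]T)
            (eb' : ty (b [ σ ]t) ≡ 𝔹) →
            elim C ct cf b e₁ et e₂ ef eb [ σ ]t
              ≡ elim (C [ ⟨ σ ∘ p , q ⟩ e₀ ]T) (ct [ σ ]t) (cf [ σ ]t) (b [ σ ]t)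
                     e₁' et' e₂' ef' eb'

-- Again in total form: a displayed type over Γ is an element of Ty• Γ
-- together with the S-type it lies over (over); a displayed term is an
-- element of Tm• Γ with its displayed type (ty•) and the S-term it lies
-- over (und).

record DBase {o h t oc hc} (S : Model o h t) (𝒞 : Category oc hc)
       (F : Functor 𝒞 (Model.cat S)) (d : Level)
       : Set (o ⊔ h ⊔ t ⊔ oc ⊔ hc ⊔ lsuc d) where
  private
    module S = Model S
    module 𝒞 = Category 𝒞
  open Functor F
  infixl 8 _[_]T• _[_]t•
  field
    Ty•    : 𝒞.Ob → Set d
    over   : ∀ {Γ} → Ty• Γ → S.Ty (F₀ Γ)
    _[_]T• : ∀ {Γ Δ} → Ty• Γ → 𝒞.Hom Δ Γ → Ty• Δ
    over[] : ∀ {Γ Δ} (A : Ty• Γ) (ρ : 𝒞.Hom Δ Γ) →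
             over (A [ ρ ]T•) ≡ over A S.[ F₁ ρ ]T
    [id]T• : ∀ {Γ} (A : Ty• Γ) → A [ 𝒞.id ]T• ≡ A
    [∘]T•  : ∀ {Γ Δ Θ} (A : Ty• Γ) (ρ : 𝒞.Hom Δ Γ) (τ : 𝒞.Hom Θ Δ) →
             A [ ρ 𝒞.∘ τ ]T• ≡ A [ ρ ]T• [ τ ]T•
    Tm•    : 𝒞.Ob → Set d
    ty•    : ∀ {Γ} → Tm• Γ → Ty• Γ
    und    : ∀ {Γ} → Tm• Γ → S.Tm (F₀ Γ)
    ty-und : ∀ {Γ} (a : Tm• Γ) → S.ty (und a) ≡ over (ty• a)
    _[_]t• : ∀ {Γ Δ} → Tm• Γ → 𝒞.Hom Δ Γ → Tm• Δ
    ty•[]  : ∀ {Γ Δ} (a : Tm• Γ) (ρ : 𝒞.Hom Δ Γ) → ty• (a [ ρ ]t•) ≡ ty• a [ ρ ]T•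
    und[]  : ∀ {Γ Δ} (a : Tm• Γ) (ρ : 𝒞.Hom Δ Γ) →
             und (a [ ρ ]t•) ≡ und a S.[ F₁ ρ ]t
    [id]t• : ∀ {Γ} (a : Tm• Γ) → a [ 𝒞.id ]t• ≡ a
    [∘]t•  : ∀ {Γ Δ Θ} (a : Tm• Γ) (ρ : 𝒞.Hom Δ Γ) (τ : 𝒞.Hom Θ Δ) →
             a [ ρ 𝒞.∘ τ ]t• ≡ a [ ρ ]t• [ τ ]t•

module _ {o h t oc hc d} {S : Model o h t} {𝒞 : Category oc hc}
         {F : Functor 𝒞 (Model.cat S)} (D : DBase S 𝒞 F d) where
  private
    module S = Model S
    module 𝒞 = Category 𝒞
  open Functor F
  open DBase D

  -- A displayed type over the (non-existent) displayed context extension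
  -- "Γ ▹ A•", lying over B : Ty (FΓ ▹ A₀): a natural family of displayed
  -- types indexed by (Δ, ρ : Δ → Γ, a• : Tm•(Δ, A•[ρ])), the one at
  -- (ρ, a•) lying over B[⟨Fρ, und a•⟩].  (This is the presheaf-level
  -- reading of Π• : (A• : Ty•(A)) → ((a : Tm A) → Tm•(A•,a) → Ty•(B a)) → …)
  record TyFam {Γ} (A : Ty• Γ) (A₀ : S.Ty (F₀ Γ)) (B : S.Ty (F₀ Γ S.▹ A₀))
         : Set (oc ⊔ hc ⊔ t ⊔ d) where
    field
      fam     : ∀ {Δ} (ρ : 𝒞.Hom Δ Γ) (a : Tm• Δ) → ty• a ≡ A [ ρ ]T• → Ty• Δ
      fam-over : ∀ {Δ} (ρ : 𝒞.Hom Δ Γ) (a : Tm• Δ) (e : ty• a ≡ A [ ρ ]T•)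
                 (e' : S.ty (und a) ≡ A₀ S.[ F₁ ρ ]T) →
                 over (fam ρ a e) ≡ B S.[ S.⟨ F₁ ρ , und a ⟩ e' ]T
      fam-nat : ∀ {Δ Θ} (ρ : 𝒞.Hom Δ Γ) (a : Tm• Δ) (e : ty• a ≡ A [ ρ ]T•)
                (τ : 𝒞.Hom Θ Δ) (e' : ty• (a [ τ ]t•) ≡ A [ ρ 𝒞.∘ τ ]T•) →
                fam ρ a e [ τ ]T• ≡ fam (ρ 𝒞.∘ τ) (a [ τ ]t•) e'
  open TyFam public

  record TmFam {Γ} {A : Ty• Γ} {A₀ : S.Ty (F₀ Γ)} {B : S.Ty (F₀ Γ S.▹ A₀)}
         (B• : TyFam A A₀ B) (b : S.Tm (F₀ Γ S.▹ A₀))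
         : Set (oc ⊔ hc ⊔ t ⊔ d) where
    field
      tfam    : ∀ {Δ} (ρ : 𝒞.Hom Δ Γ) (a : Tm• Δ) → ty• a ≡ A [ ρ ]T• → Tm• Δ
      tfam-ty : ∀ {Δ} (ρ : 𝒞.Hom Δ Γ) (a : Tm• Δ) (e : ty• a ≡ A [ ρ ]T•) →
                ty• (tfam ρ a e) ≡ fam B• ρ a e
      tfam-und : ∀ {Δ} (ρ : 𝒞.Hom Δ Γ) (a : Tm• Δ) (e : ty• a ≡ A [ ρ ]T•)
                 (e' : S.ty (und a) ≡ A₀ S.[ F₁ ρ ]T) →
                 und (tfam ρ a e) ≡ b S.[ S.⟨ F₁ ρ , und a ⟩ e' ]t
      tfam-nat : ∀ {Δ Θ} (ρ : 𝒞.Hom Δ Γ) (a : Tm• Δ) (e : ty• a ≡ A [ ρ ]T•)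
                 (τ : 𝒞.Hom Θ Δ) (e' : ty• (a [ τ ]t•) ≡ A [ ρ 𝒞.∘ τ ]T•) →
                 tfam ρ a e [ τ ]t• ≡ tfam (ρ 𝒞.∘ τ) (a [ τ ]t•) e'
  open TmFam public

record DOps {o h t oc hc d} {S : Model o h t} {𝒞 : Category oc hc}
       {F : Functor 𝒞 (Model.cat S)} (D : DBase S 𝒞 F d)
       : Set (o ⊔ h ⊔ t ⊔ oc ⊔ hc ⊔ d) where
  private
    module S = Model S
    module 𝒞 = Category 𝒞
  open Functor F
  open DBase D
  field
    Π•      : ∀ {Γ} (A : Ty• Γ) (B : S.Ty (F₀ Γ S.▹ over A)) →
             TyFam D A (over A) B → Ty• Γ
    over-Π• : ∀ {Γ} (A : Ty• Γ) (B : S.Ty (F₀ Γ S.▹ over A))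
             (B• : TyFam D A (over A) B) → over (Π• A B B•) ≡ S.Π (over A) B
    Π•[]    : ∀ {Γ Δ} (A : Ty• Γ) (B : S.Ty (F₀ Γ S.▹ over A))
             (B• : TyFam D A (over A) B) (ρ : 𝒞.Hom Δ Γ)
             (e₀ : S.ty (S.q {A = over (A [ ρ ]T•)}) ≡ over A S.[ F₁ ρ S.∘ S.p ]T)
             (B•' : TyFam D (A [ ρ ]T•) (over (A [ ρ ]T•))
                            (B S.[ S.⟨ F₁ ρ S.∘ S.p , S.q ⟩ e₀ ]T)) →
             (∀ {Θ} (τ : 𝒞.Hom Θ Δ) (a : Tm• Θ) (e : ty• a ≡ A [ ρ ]T• [ τ ]T•)
                (e' : ty• a ≡ A [ ρ 𝒞.∘ τ ]T•) →
                fam B•' τ a e ≡ fam B• (ρ 𝒞.∘ τ) a e') →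
             Π• A B B• [ ρ ]T•
               ≡ Π• (A [ ρ ]T•) (B S.[ S.⟨ F₁ ρ S.∘ S.p , S.q ⟩ e₀ ]T) B•'
    app•    : ∀ {Γ} (A : Ty• Γ) (B : S.Ty (F₀ Γ S.▹ over A))
             (B• : TyFam D A (over A) B) (t : Tm• Γ) → ty• t ≡ Π• A B B• →
             (e : S.ty (und t) ≡ S.Π (over A) B) →
             TmFam D B• (S.app (over A) B (und t) e)
    lam•    : ∀ {Γ} (A : Ty• Γ) (B : S.Ty (F₀ Γ S.▹ over A))
             (B• : TyFam D A (over A) B) (b : S.Tm (F₀ Γ S.▹ over A)) →
             S.ty b ≡ B → TmFam D B• b → Tm• Γ
    ty•-lam• : ∀ {Γ} (A : Ty• Γ) (B : S.Ty (F₀ Γ S.▹ over A))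
             (B• : TyFam D A (over A) B) (b : S.Tm (F₀ Γ S.▹ over A))
             (eb : S.ty b ≡ B) (f : TmFam D B• b) →
             ty• (lam• A B B• b eb f) ≡ Π• A B B•
    und-lam• : ∀ {Γ} (A : Ty• Γ) (B : S.Ty (F₀ Γ S.▹ over A))
             (B• : TyFam D A (over A) B) (b : S.Tm (F₀ Γ S.▹ over A))
             (eb : S.ty b ≡ B) (f : TmFam D B• b) →
             und (lam• A B B• b eb f) ≡ S.lam (over A) B b eb
    app•-lam• : ∀ {Γ} (A : Ty• Γ) (B : S.Ty (F₀ Γ S.▹ over A))
             (B• : TyFam D A (over A) B) (b : S.Tm (F₀ Γ S.▹ over A))
             (eb : S.ty b ≡ B) (f : TmFam D B• b)
             (e₁ : ty• (lam• A B B• b eb f) ≡ Π• A B B•)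
             (e₂ : S.ty (und (lam• A B B• b eb f)) ≡ S.Π (over A) B) →
             ∀ {Δ} (ρ : 𝒞.Hom Δ Γ) (a : Tm• Δ) (e : ty• a ≡ A [ ρ ]T•) →
             tfam (app• A B B• (lam• A B B• b eb f) e₁ e₂) ρ a e ≡ tfam f ρ a e
    lam•-app• : ∀ {Γ} (A : Ty• Γ) (B : S.Ty (F₀ Γ S.▹ over A))
             (B• : TyFam D A (over A) B) (t : Tm• Γ) (et : ty• t ≡ Π• A B B•)
             (e : S.ty (und t) ≡ S.Π (over A) B)
             (eb : S.ty (S.app (over A) B (und t) e) ≡ B) →
             lam• A B B• (S.app (over A) B (und t) e) eb (app• A B B• t et e) ≡ t
    app•[]  : ∀ {Γ Δ} (A : Ty• Γ) (B : S.Ty (F₀ Γ S.▹ over A))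
             (B• : TyFam D A (over A) B) (t : Tm• Γ) (et : ty• t ≡ Π• A B B•)
             (e : S.ty (und t) ≡ S.Π (over A) B) (ρ : 𝒞.Hom Δ Γ)
             (e₀ : S.ty (S.q {A = over (A [ ρ ]T•)}) ≡ over A S.[ F₁ ρ S.∘ S.p ]T)
             (B•' : TyFam D (A [ ρ ]T•) (over (A [ ρ ]T•))
                            (B S.[ S.⟨ F₁ ρ S.∘ S.p , S.q ⟩ e₀ ]T)) →
             (∀ {Θ} (τ : 𝒞.Hom Θ Δ) (a : Tm• Θ) (e : ty• a ≡ A [ ρ ]T• [ τ ]T•)
                (e' : ty• a ≡ A [ ρ 𝒞.∘ τ ]T•) →
                fam B•' τ a e ≡ fam B• (ρ 𝒞.∘ τ) a e') →
             (et' : ty• (t [ ρ ]t•)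
                      ≡ Π• (A [ ρ ]T•) (B S.[ S.⟨ F₁ ρ S.∘ S.p , S.q ⟩ e₀ ]T) B•')
             (e' : S.ty (und (t [ ρ ]t•))
                     ≡ S.Π (over (A [ ρ ]T•)) (B S.[ S.⟨ F₁ ρ S.∘ S.p , S.q ⟩ e₀ ]T)) →
             ∀ {Θ} (τ : 𝒞.Hom Θ Δ) (a : Tm• Θ) (e₃ : ty• a ≡ A [ ρ ]T• [ τ ]T•)
               (e₄ : ty• a ≡ A [ ρ 𝒞.∘ τ ]T•) →
             tfam (app• A B B• t et e) (ρ 𝒞.∘ τ) a e₄
               ≡ tfam (app• (A [ ρ ]T•) (B S.[ S.⟨ F₁ ρ S.∘ S.p , S.q ⟩ e₀ ]T) B•'
                              (t [ ρ ]t•) et' e') τ a e₃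
    𝔹•       : ∀ {Γ} → Ty• Γ
    over-𝔹•  : ∀ {Γ} → over (𝔹• {Γ}) ≡ S.𝔹
    𝔹•[]     : ∀ {Γ Δ} (ρ : 𝒞.Hom Δ Γ) → 𝔹• [ ρ ]T• ≡ 𝔹•
    true•    : ∀ {Γ} → Tm• Γ
    false•   : ∀ {Γ} → Tm• Γ
    ty•-true•  : ∀ {Γ} → ty• (true• {Γ}) ≡ 𝔹•
    ty•-false• : ∀ {Γ} → ty• (false• {Γ}) ≡ 𝔹•
    und-true•  : ∀ {Γ} → und (true• {Γ}) ≡ S.true
    und-false• : ∀ {Γ} → und (false• {Γ}) ≡ S.false
    true•[]  : ∀ {Γ Δ} (ρ : 𝒞.Hom Δ Γ) → true• [ ρ ]t• ≡ true•
    false•[] : ∀ {Γ Δ} (ρ : 𝒞.Hom Δ Γ) → false• [ ρ ]t• ≡ false•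
    elim•    : ∀ {Γ} (C : S.Ty (F₀ Γ S.▹ S.𝔹)) (C• : TyFam D 𝔹• S.𝔹 C)
             (ct cf b : Tm• Γ)
             (e₁ : ty• true• ≡ 𝔹• [ 𝒞.id ]T•) → ty• ct ≡ fam C• 𝒞.id true• e₁ →
             (e₂ : ty• false• ≡ 𝔹• [ 𝒞.id ]T•) → ty• cf ≡ fam C• 𝒞.id false• e₂ →
             ty• b ≡ 𝔹• → Tm• Γ
    ty•-elim• : ∀ {Γ} (C : S.Ty (F₀ Γ S.▹ S.𝔹)) (C• : TyFam D 𝔹• S.𝔹 C)
             (ct cf b : Tm• Γ)
             (e₁ : ty• true• ≡ 𝔹• [ 𝒞.id ]T•) (et : ty• ct ≡ fam C• 𝒞.id true• e₁)
             (e₂ : ty• false• ≡ 𝔹• [ 𝒞.id ]T•) (ef : ty• cf ≡ fam C• 𝒞.id false• e₂)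
             (eb : ty• b ≡ 𝔹•) (e₃ : ty• b ≡ 𝔹• [ 𝒞.id ]T•) →
             ty• (elim• C C• ct cf b e₁ et e₂ ef eb) ≡ fam C• 𝒞.id b e₃
    und-elim• : ∀ {Γ} (C : S.Ty (F₀ Γ S.▹ S.𝔹)) (C• : TyFam D 𝔹• S.𝔹 C)
             (ct cf b : Tm• Γ)
             (e₁ : ty• true• ≡ 𝔹• [ 𝒞.id ]T•) (et : ty• ct ≡ fam C• 𝒞.id true• e₁)
             (e₂ : ty• false• ≡ 𝔹• [ 𝒞.id ]T•) (ef : ty• cf ≡ fam C• 𝒞.id false• e₂)
             (eb : ty• b ≡ 𝔹•)
             (s₁ : S.ty S.true ≡ S.𝔹 S.[ S.id ]T)
             (st : S.ty (und ct) ≡ C S.[ S.⟨ S.id , S.true ⟩ s₁ ]T)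
             (s₂ : S.ty S.false ≡ S.𝔹 S.[ S.id ]T)
             (sf : S.ty (und cf) ≡ C S.[ S.⟨ S.id , S.false ⟩ s₂ ]T)
             (sb : S.ty (und b) ≡ S.𝔹) →
             und (elim• C C• ct cf b e₁ et e₂ ef eb)
               ≡ S.elim C (und ct) (und cf) (und b) s₁ st s₂ sf sb
    elim•-true : ∀ {Γ} (C : S.Ty (F₀ Γ S.▹ S.𝔹)) (C• : TyFam D 𝔹• S.𝔹 C)
             (ct cf : Tm• Γ)
             (e₁ : ty• true• ≡ 𝔹• [ 𝒞.id ]T•) (et : ty• ct ≡ fam C• 𝒞.id true• e₁)
             (e₂ : ty• false• ≡ 𝔹• [ 𝒞.id ]T•) (ef : ty• cf ≡ fam C• 𝒞.id false• e₂)
             (eb : ty• true• ≡ 𝔹•) →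
             elim• C C• ct cf true• e₁ et e₂ ef eb ≡ ct
    elim•-false : ∀ {Γ} (C : S.Ty (F₀ Γ S.▹ S.𝔹)) (C• : TyFam D 𝔹• S.𝔹 C)
             (ct cf : Tm• Γ)
             (e₁ : ty• true• ≡ 𝔹• [ 𝒞.id ]T•) (et : ty• ct ≡ fam C• 𝒞.id true• e₁)
             (e₂ : ty• false• ≡ 𝔹• [ 𝒞.id ]T•) (ef : ty• cf ≡ fam C• 𝒞.id false• e₂)
             (eb : ty• false• ≡ 𝔹•) →
             elim• C C• ct cf false• e₁ et e₂ ef eb ≡ cf
    elim•[]  : ∀ {Γ Δ} (C : S.Ty (F₀ Γ S.▹ S.𝔹)) (C• : TyFam D 𝔹• S.𝔹 C)
             (ct cf b : Tm• Γ)
             (e₁ : ty• true• ≡ 𝔹• [ 𝒞.id ]T•) (et : ty• ct ≡ fam C• 𝒞.id true• e₁)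
             (e₂ : ty• false• ≡ 𝔹• [ 𝒞.id ]T•) (ef : ty• cf ≡ fam C• 𝒞.id false• e₂)
             (eb : ty• b ≡ 𝔹•) (ρ : 𝒞.Hom Δ Γ)
             (e₀ : S.ty (S.q {A = S.𝔹 {F₀ Δ}}) ≡ S.𝔹 S.[ F₁ ρ S.∘ S.p ]T)
             (C•' : TyFam D 𝔹• S.𝔹 (C S.[ S.⟨ F₁ ρ S.∘ S.p , S.q ⟩ e₀ ]T)) →
             (∀ {Θ} (τ : 𝒞.Hom Θ Δ) (a : Tm• Θ) (e : ty• a ≡ 𝔹• [ τ ]T•)
                (e' : ty• a ≡ 𝔹• [ ρ 𝒞.∘ τ ]T•) →
                fam C•' τ a e ≡ fam C• (ρ 𝒞.∘ τ) a e') →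
             (e₁' : ty• true• ≡ 𝔹• [ 𝒞.id ]T•)
             (et' : ty• (ct [ ρ ]t•) ≡ fam C•' 𝒞.id true• e₁')
             (e₂' : ty• false• ≡ 𝔹• [ 𝒞.id ]T•)
             (ef' : ty• (cf [ ρ ]t•) ≡ fam C•' 𝒞.id false• e₂')
             (eb' : ty• (b [ ρ ]t•) ≡ 𝔹•) →
             elim• C C• ct cf b e₁ et e₂ ef eb [ ρ ]t•
               ≡ elim• (C S.[ S.⟨ F₁ ρ S.∘ S.p , S.q ⟩ e₀ ]T) C•'
                       (ct [ ρ ]t•) (cf [ ρ ]t•) (b [ ρ ]t•) e₁' et' e₂' ef' eb'

record DModel {o h t oc hc} (S : Model o h t) (𝒞 : Category oc hc)
       (F : Functor 𝒞 (Model.cat S)) (d : Level)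
       : Set (o ⊔ h ⊔ t ⊔ oc ⊔ hc ⊔ lsuc d) where
  field
    base : DBase S 𝒞 F d
    ops  : DOps base
  open DBase base public
  open DOps ops public

-- Context extensions for a displayed model S† over G : 𝒫 → S.
-- (c · A†, p†, q†) classifies pairs (ρ : d → c, a† : Tm†(d, A†[ρ]));
-- the S-term of the classified triple is und a†, so the triple
-- (morphism, term, displayed term) is (ρ, und a†, a†).

record DExt {o h t op hp d} {S : Model o h t} {𝒫 : Category op hp}
       {G : Functor 𝒫 (Model.cat S)} (D : DModel S 𝒫 G d)
       : Set (o ⊔ h ⊔ t ⊔ op ⊔ hp ⊔ d) where
  private
    module S = Model S
    module 𝒫 = Category 𝒫
  open Functor G
  open DModel D
  infixl 6 _·_
  field
    _·_    : (c : 𝒫.Ob) → Ty• c → 𝒫.Ob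
    p†     : ∀ {c} {A : Ty• c} → 𝒫.Hom (c · A) c
    q†     : ∀ {c} {A : Ty• c} → Tm• (c · A)
    ty-q†  : ∀ {c} (A : Ty• c) → ty• (q† {A = A}) ≡ A [ p† ]T•
    ⟨_,_⟩† : ∀ {c c'} {A : Ty• c} (ρ : 𝒫.Hom c' c) (a : Tm• c') →
             ty• a ≡ A [ ρ ]T• → 𝒫.Hom c' (c · A)
    p∘⟨⟩†  : ∀ {c c'} {A : Ty• c} (ρ : 𝒫.Hom c' c) (a : Tm• c')
             (e : ty• a ≡ A [ ρ ]T•) → p† 𝒫.∘ ⟨ ρ , a ⟩† e ≡ ρ
    q[⟨⟩]† : ∀ {c c'} {A : Ty• c} (ρ : 𝒫.Hom c' c) (a : Tm• c')
             (e : ty• a ≡ A [ ρ ]T•) → q† [ ⟨ ρ , a ⟩† e ]t• ≡ a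
    ⟨⟩†-unique : ∀ {c c'} {A : Ty• c} (ρ : 𝒫.Hom c' c) (a : Tm• c')
             (e : ty• a ≡ A [ ρ ]T•) (σ : 𝒫.Hom c' (c · A)) →
             p† 𝒫.∘ σ ≡ ρ → q† [ σ ]t• ≡ a → σ ≡ ⟨ ρ , a ⟩† e
    ext-inv : ∀ {c} (A : Ty• c)
             (e : S.ty (und (q† {A = A})) ≡ over A S.[ F₁ (p† {A = A}) ]T) →
             Σ (S.Hom (F₀ c S.▹ over A) (F₀ (c · A))) λ g →
               (g S.∘ S.⟨ F₁ p† , und q† ⟩ e ≡ S.id)
               × (S.⟨ F₁ p† , und q† ⟩ e S.∘ g ≡ S.id)

record Factorization {o h t oc hc d} {S : Model o h t} {𝒞 : Category oc hc}
       {F : Functor 𝒞 (Model.cat S)} (S• : DModel S 𝒞 F d) (op hp d' : Level)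
       : Set (o ⊔ h ⊔ t ⊔ oc ⊔ hc ⊔ d ⊔ lsuc (op ⊔ hp ⊔ d')) where
  private
    module S = Model S
    module 𝒞 = Category 𝒞
    module S• = DModel S•
    module F = Functor F
  field
    𝒫    : Category op hp
    Y    : Functor 𝒞 𝒫
    G    : Functor 𝒫 S.cat
    S†   : DModel S 𝒫 G d'
    S†-ext : DExt S†
  private
    module 𝒫 = Category 𝒫
    module Y = Functor Y
    module G = Functor G
    module S† = DModel S†
  field
    GY₀  : ∀ Γ → G.F₀ (Y.F₀ Γ) ≡ F.F₀ Γ
    GY₁  : ∀ {Γ Δ} (ρ : 𝒞.Hom Δ Γ) →
           subst₂ S.Hom (GY₀ Δ) (GY₀ Γ) (G.F₁ (Y.F₁ ρ)) ≡ F.F₁ ρ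
    Y⁻¹  : ∀ {Γ Δ} → 𝒫.Hom (Y.F₀ Δ) (Y.F₀ Γ) → 𝒞.Hom Δ Γ
    YY⁻¹ : ∀ {Γ Δ} (f : 𝒫.Hom (Y.F₀ Δ) (Y.F₀ Γ)) → Y.F₁ (Y⁻¹ f) ≡ f
    Y⁻¹Y : ∀ {Γ Δ} (ρ : 𝒞.Hom Δ Γ) → Y⁻¹ (Y.F₁ ρ) ≡ ρ
    φ    : ∀ {Γ} → S•.Ty• Γ → S†.Ty• (Y.F₀ Γ)
    φ⁻¹  : ∀ {Γ} → S†.Ty• (Y.F₀ Γ) → S•.Ty• Γ
    φφ⁻¹ : ∀ {Γ} (A : S†.Ty• (Y.F₀ Γ)) → φ (φ⁻¹ A) ≡ A
    φ⁻¹φ : ∀ {Γ} (A : S•.Ty• Γ) → φ⁻¹ (φ A) ≡ A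
    φ-over : ∀ {Γ} (A : S•.Ty• Γ) →
           S†.over (φ A) ≡ subst S.Ty (sym (GY₀ Γ)) (S•.over A)
    φ-nat : ∀ {Γ Δ} (A : S•.Ty• Γ) (ρ : 𝒞.Hom Δ Γ) →
           φ (A S•.[ ρ ]T•) ≡ φ A S†.[ Y.F₁ ρ ]T•
    ψ    : ∀ {Γ} → S•.Tm• Γ → S†.Tm• (Y.F₀ Γ)
    ψ⁻¹  : ∀ {Γ} → S†.Tm• (Y.F₀ Γ) → S•.Tm• Γ
    ψψ⁻¹ : ∀ {Γ} (a : S†.Tm• (Y.F₀ Γ)) → ψ (ψ⁻¹ a) ≡ a
    ψ⁻¹ψ : ∀ {Γ} (a : S•.Tm• Γ) → ψ⁻¹ (ψ a) ≡ a
    ψ-ty : ∀ {Γ} (a : S•.Tm• Γ) → S†.ty• (ψ a) ≡ φ (S•.ty• a)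
    ψ-und : ∀ {Γ} (a : S•.Tm• Γ) →
           S†.und (ψ a) ≡ subst S.Tm (sym (GY₀ Γ)) (S•.und a)
    ψ-nat : ∀ {Γ Δ} (a : S•.Tm• Γ) (ρ : 𝒞.Hom Δ Γ) →
           ψ (a S•.[ ρ ]t•) ≡ ψ a S†.[ Y.F₁ ρ ]t•

record Section {o h t oc hc d op hp d'} {S : Model o h t} {𝒞 : Category oc hc}
       {F : Functor 𝒞 (Model.cat S)} {S• : DModel S 𝒞 F d}
       (fac : Factorization S• op hp d')
       : Set (o ⊔ h ⊔ t ⊔ op ⊔ hp ⊔ d') where
  private
    module S = Model S
    module fac = Factorization fac
    module P = Category fac.𝒫
    module G = Functor fac.G
    module S† = DModel fac.S†
    module X = DExt fac.S†-ext
  field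
    S₀ : Functor S.cat fac.𝒫
  private
    module S₀ = Functor S₀
  field
    θ     : ∀ Γ → S.Hom (G.F₀ (S₀.F₀ Γ)) Γ
    θ⁻¹   : ∀ Γ → S.Hom Γ (G.F₀ (S₀.F₀ Γ))
    θθ⁻¹  : ∀ Γ → θ Γ S.∘ θ⁻¹ Γ ≡ S.id
    θ⁻¹θ  : ∀ Γ → θ⁻¹ Γ S.∘ θ Γ ≡ S.id
    θ-nat : ∀ {Γ Δ} (σ : S.Hom Δ Γ) → θ Γ S.∘ G.F₁ (S₀.F₁ σ) ≡ σ S.∘ θ Δ
    S₀-◇  : IsTerminal fac.𝒫 (S₀.F₀ S.◇)
    S₀T    : ∀ {Γ} → S.Ty Γ → S†.Ty• (S₀.F₀ Γ)
    over-S₀T : ∀ {Γ} (A : S.Ty Γ) → S†.over (S₀T A) ≡ A S.[ θ Γ ]T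
    S₀T[]  : ∀ {Γ Δ} (A : S.Ty Γ) (σ : S.Hom Δ Γ) →
             S₀T (A S.[ σ ]T) ≡ S₀T A S†.[ S₀.F₁ σ ]T•
    S₀t    : ∀ {Γ} → S.Tm Γ → S†.Tm• (S₀.F₀ Γ)
    ty-S₀t : ∀ {Γ} (a : S.Tm Γ) → S†.ty• (S₀t a) ≡ S₀T (S.ty a)
    und-S₀t : ∀ {Γ} (a : S.Tm Γ) → S†.und (S₀t a) ≡ a S.[ θ Γ ]t
    S₀t[]  : ∀ {Γ Δ} (a : S.Tm Γ) (σ : S.Hom Δ Γ) →
             S₀t (a S.[ σ ]t) ≡ S₀t a S†.[ S₀.F₁ σ ]t•
    S₀▹⁻¹  : ∀ {Γ} (A : S.Ty Γ) → P.Hom (S₀.F₀ Γ X.· S₀T A) (S₀.F₀ (Γ S.▹ A))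
    S₀▹-inv₁ : ∀ {Γ} (A : S.Ty Γ)
             (e : S†.ty• (S₀t (S.q {A = A})) ≡ S₀T A S†.[ S₀.F₁ (S.p {A = A}) ]T•) →
             S₀▹⁻¹ A P.∘ X.⟨ S₀.F₁ S.p , S₀t S.q ⟩† e ≡ P.id
    S₀▹-inv₂ : ∀ {Γ} (A : S.Ty Γ)
             (e : S†.ty• (S₀t (S.q {A = A})) ≡ S₀T A S†.[ S₀.F₁ (S.p {A = A}) ]T•) →
             X.⟨ S₀.F₁ S.p , S₀t S.q ⟩† e P.∘ S₀▹⁻¹ A ≡ P.id
    S₀-Π   : ∀ {Γ} (A : S.Ty Γ) (B : S.Ty (Γ S.▹ A))
             (e : S.ty (S.q {A = S†.over (S₀T A)}) ≡ A S.[ θ Γ S.∘ S.p ]T)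
             (B† : TyFam S†.base (S₀T A) (S†.over (S₀T A))
                         (B S.[ S.⟨ θ Γ S.∘ S.p , S.q ⟩ e ]T)) →
             (∀ {c} (ρ : P.Hom c (S₀.F₀ Γ)) (a : S†.Tm• c)
                (e' : S†.ty• a ≡ S₀T A S†.[ ρ ]T•) →
                fam B† ρ a e' ≡ S₀T B S†.[ S₀▹⁻¹ A P.∘ X.⟨ ρ , a ⟩† e' ]T•) →
             S₀T (S.Π A B)
               ≡ S†.Π• (S₀T A) (B S.[ S.⟨ θ Γ S.∘ S.p , S.q ⟩ e ]T) B†
    S₀-app : ∀ {Γ} (A : S.Ty Γ) (B : S.Ty (Γ S.▹ A)) (t : S.Tm Γ)
             (et : S.ty t ≡ S.Π A B)
             (e : S.ty (S.q {A = S†.over (S₀T A)}) ≡ A S.[ θ Γ S.∘ S.p ]T)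
             (B† : TyFam S†.base (S₀T A) (S†.over (S₀T A))
                         (B S.[ S.⟨ θ Γ S.∘ S.p , S.q ⟩ e ]T)) →
             (∀ {c} (ρ : P.Hom c (S₀.F₀ Γ)) (a : S†.Tm• c)
                (e' : S†.ty• a ≡ S₀T A S†.[ ρ ]T•) →
                fam B† ρ a e' ≡ S₀T B S†.[ S₀▹⁻¹ A P.∘ X.⟨ ρ , a ⟩† e' ]T•) →
             (et† : S†.ty• (S₀t t)
                      ≡ S†.Π• (S₀T A) (B S.[ S.⟨ θ Γ S.∘ S.p , S.q ⟩ e ]T) B†)
             (e₂ : S.ty (S†.und (S₀t t))
                     ≡ S.Π (S†.over (S₀T A)) (B S.[ S.⟨ θ Γ S.∘ S.p , S.q ⟩ e ]T)) →
             ∀ {c} (ρ : P.Hom c (S₀.F₀ Γ)) (a : S†.Tm• c)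
               (e' : S†.ty• a ≡ S₀T A S†.[ ρ ]T•) →
             tfam (S†.app• (S₀T A) (B S.[ S.⟨ θ Γ S.∘ S.p , S.q ⟩ e ]T) B†
                           (S₀t t) et† e₂) ρ a e'
               ≡ S₀t (S.app A B t et) S†.[ S₀▹⁻¹ A P.∘ X.⟨ ρ , a ⟩† e' ]t•
    S₀-𝔹     : ∀ {Γ} → S₀T (S.𝔹 {Γ}) ≡ S†.𝔹•
    S₀-true  : ∀ {Γ} → S₀t (S.true {Γ}) ≡ S†.true•
    S₀-false : ∀ {Γ} → S₀t (S.false {Γ}) ≡ S†.false•
    S₀-elim  : ∀ {Γ} (C : S.Ty (Γ S.▹ S.𝔹)) (ct cf b : S.Tm Γ)
             (e₁ : S.ty S.true ≡ S.𝔹 S.[ S.id ]T)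
             (et : S.ty ct ≡ C S.[ S.⟨ S.id , S.true ⟩ e₁ ]T)
             (e₂ : S.ty S.false ≡ S.𝔹 S.[ S.id ]T)
             (ef : S.ty cf ≡ C S.[ S.⟨ S.id , S.false ⟩ e₂ ]T)
             (eb : S.ty b ≡ S.𝔹)
             (e : S.ty (S.q {A = S.𝔹 {G.F₀ (S₀.F₀ Γ)}}) ≡ S.𝔹 S.[ θ Γ S.∘ S.p ]T)
             (C† : TyFam S†.base S†.𝔹• S.𝔹 (C S.[ S.⟨ θ Γ S.∘ S.p , S.q ⟩ e ]T)) →
             (∀ {c} (ρ : P.Hom c (S₀.F₀ Γ)) (a : S†.Tm• c)
                (e' : S†.ty• a ≡ S†.𝔹• S†.[ ρ ]T•)
                (e'' : S†.ty• a ≡ S₀T S.𝔹 S†.[ ρ ]T•) →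
                fam C† ρ a e' ≡ S₀T C S†.[ S₀▹⁻¹ S.𝔹 P.∘ X.⟨ ρ , a ⟩† e'' ]T•) →
             (e₁† : S†.ty• S†.true• ≡ S†.𝔹• S†.[ P.id ]T•)
             (et† : S†.ty• (S₀t ct) ≡ fam C† P.id S†.true• e₁†)
             (e₂† : S†.ty• S†.false• ≡ S†.𝔹• S†.[ P.id ]T•)
             (ef† : S†.ty• (S₀t cf) ≡ fam C† P.id S†.false• e₂†)
             (eb† : S†.ty• (S₀t b) ≡ S†.𝔹•) →
             S₀t (S.elim C ct cf b e₁ et e₂ ef eb)
               ≡ S†.elim• (C S.[ S.⟨ θ Γ S.∘ S.p , S.q ⟩ e ]T) C†
                          (S₀t ct) (S₀t cf) (S₀t b) e₁† et† e₂† ef† eb†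

module Inserter {o h t oc hc d op hp d'} {S : Model o h t} {𝒞 : Category oc hc}
       {F : Functor 𝒞 (Model.cat S)} {S• : DModel S 𝒞 F d}
       {fac : Factorization S• op hp d'} (sec : Section fac) where
  private
    module S = Model S
    module 𝒞 = Category 𝒞
    module F = Functor F
    module fac = Factorization fac
    module P = Category fac.𝒫
    module G = Functor fac.G
    module Y = Functor fac.Y
    module sec = Section sec
    module S₀ = Functor sec.S₀

  record InsOb : Set (oc ⊔ hp ⊔ h) where
    constructor insOb
    field
      ob : 𝒞.Ob
      ι  : P.Hom (Y.F₀ ob) (S₀.F₀ (F.F₀ ob))
      Gι : subst (λ X → S.Hom X (G.F₀ (S₀.F₀ (F.F₀ ob)))) (fac.GY₀ ob) (G.F₁ ι)
             ≡ sec.θ⁻¹ (F.F₀ ob)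
  open InsOb public

  record InsHom (X Z : InsOb) : Set (hc ⊔ hp) where
    constructor insHom
    field
      mor    : 𝒞.Hom (ob X) (ob Z)
      .comm  : ι Z P.∘ Y.F₁ mor ≡ S₀.F₁ (F.F₁ mor) P.∘ ι X
  open InsHom public

  private
    insHom-≡ : ∀ {X Z} {f g : InsHom X Z} → mor f ≡ mor g → f ≡ g
    insHom-≡ refl = refl

    open ≡-Reasoning

    id-comm : ∀ (X : InsOb) →
              ι X P.∘ Y.F₁ 𝒞.id ≡ S₀.F₁ (F.F₁ 𝒞.id) P.∘ ι X
    id-comm X = begin
      ι X P.∘ Y.F₁ 𝒞.id            ≡⟨ cong (ι X P.∘_) Y.F-id ⟩
      ι X P.∘ P.id                 ≡⟨ P.idʳ (ι X) ⟩
      ι X                          ≡⟨ sym (P.idˡ (ι X)) ⟩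
      P.id P.∘ ι X                 ≡⟨ cong (P._∘ ι X) (sym S₀.F-id) ⟩
      S₀.F₁ S.id P.∘ ι X           ≡⟨ cong (λ k → S₀.F₁ k P.∘ ι X) (sym F.F-id) ⟩
      S₀.F₁ (F.F₁ 𝒞.id) P.∘ ι X    ∎

    ∘-comm : ∀ {X Z W : InsOb} (f : 𝒞.Hom (ob Z) (ob W)) (g : 𝒞.Hom (ob X) (ob Z)) →
             ι W P.∘ Y.F₁ f ≡ S₀.F₁ (F.F₁ f) P.∘ ι Z →
             ι Z P.∘ Y.F₁ g ≡ S₀.F₁ (F.F₁ g) P.∘ ι X →
             ι W P.∘ Y.F₁ (f 𝒞.∘ g) ≡ S₀.F₁ (F.F₁ (f 𝒞.∘ g)) P.∘ ι X
    ∘-comm {X} {Z} {W} f g cf cg = begin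
      ι W P.∘ Y.F₁ (f 𝒞.∘ g)                      ≡⟨ cong (ι W P.∘_) (Y.F-∘ f g) ⟩
      ι W P.∘ (Y.F₁ f P.∘ Y.F₁ g)                 ≡⟨ sym (P.assoc _ _ _) ⟩
      (ι W P.∘ Y.F₁ f) P.∘ Y.F₁ g                 ≡⟨ cong (P._∘ Y.F₁ g) cf ⟩
      (S₀.F₁ (F.F₁ f) P.∘ ι Z) P.∘ Y.F₁ g         ≡⟨ P.assoc _ _ _ ⟩
      S₀.F₁ (F.F₁ f) P.∘ (ι Z P.∘ Y.F₁ g)         ≡⟨ cong (S₀.F₁ (F.F₁ f) P.∘_) cg ⟩
      S₀.F₁ (F.F₁ f) P.∘ (S₀.F₁ (F.F₁ g) P.∘ ι X) ≡⟨ sym (P.assoc _ _ _) ⟩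
      (S₀.F₁ (F.F₁ f) P.∘ S₀.F₁ (F.F₁ g)) P.∘ ι X ≡⟨ cong (P._∘ ι X) (sym (S₀.F-∘ _ _)) ⟩
      S₀.F₁ (F.F₁ f S.∘ F.F₁ g) P.∘ ι X           ≡⟨ cong (λ k → S₀.F₁ k P.∘ ι X) (sym (F.F-∘ f g)) ⟩
      S₀.F₁ (F.F₁ (f 𝒞.∘ g)) P.∘ ι X              ∎

  ℐ : Category (oc ⊔ hp ⊔ h) (hc ⊔ hp)
  ℐ = record
    { Ob    = InsOb
    ; Hom   = InsHom
    ; id    = λ {X} → insHom 𝒞.id (id-comm X)
    ; _∘_   = λ {X} {Z} {W} → λ { (insHom f cf) (insHom g cg) → insHom (f 𝒞.∘ g) (∘-comm {X} {Z} {W} f g cf cg) }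
    ; idˡ   = λ f → insHom-≡ (𝒞.idˡ (mor f))
    ; idʳ   = λ f → insHom-≡ (𝒞.idʳ (mor f))
    ; assoc = λ f g k → insHom-≡ (𝒞.assoc (mor f) (mor g) (mor k))
    }

  I : Functor ℐ 𝒞
  I = record
    { F₀   = ob
    ; F₁   = mor
    ; F-id = refl
    ; F-∘  = λ f g → refl
    }

{-# OPTIONS --safe #-}
-- Since F ⊤ is terminal, F ⊤ ≅ ◇, so S₀ (F ⊤) ≅ S₀ ◇ is terminal in 𝒫 and
-- G (S₀ (F ⊤)) ≅ F ⊤ (via θ) is terminal in 𝒮. Hence (⊤, !) is an object of
-- the inserter, the compatibility condition on G ! being an equation between
-- parallel morphisms into a terminal object, and every morphism ρ : Γ → ⊤ of
-- 𝒞 lifts to it, the inserter square commuting because it lands in S₀ (F ⊤).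
module Submission where

open import Defs
open import Data.Product using (Σ; proj₁; proj₂; _,_)
open import Relation.Binary.PropositionalEquality
  using (_≡_; refl; sym; trans; cong; module ≡-Reasoning)

module _ {o h} (C : Category o h) where
  open Category C

  terminal-hom-unique : ∀ {X T} → IsTerminal C T → (f g : Hom X T) → f ≡ g
  terminal-hom-unique tT f g = trans (proj₂ (tT _) f) (sym (proj₂ (tT _) g))

  retract-of-terminal : ∀ {A T} → IsTerminal C T →
    (i : Hom A T) (r : Hom T A) → r ∘ i ≡ id → IsTerminal C A
  retract-of-terminal {A} {T} tT i r ri X = r ∘ proj₁ (tT X) , unique
    where
      open ≡-Reasoning
      unique : ∀ g → g ≡ r ∘ proj₁ (tT X)
      unique g = begin
        g                  ≡⟨ sym (idˡ g) ⟩
        id ∘ g             ≡⟨ cong (_∘ g) (sym ri) ⟩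
        (r ∘ i) ∘ g        ≡⟨ assoc r i g ⟩
        r ∘ (i ∘ g)        ≡⟨ cong (r ∘_) (proj₂ (tT X) (i ∘ g)) ⟩
        r ∘ proj₁ (tT X)   ∎

module _ {o h o' h'} {C : Category o h} {D : Category o' h'} (H : Functor C D) where
  private
    module H = Functor H

  -- Terminal objects are isomorphic, and functors preserve isomorphisms.
  terminal-image-transport : ∀ {A B} → IsTerminal C A → IsTerminal C B →
    IsTerminal D (H.F₀ A) → IsTerminal D (H.F₀ B)
  terminal-image-transport tA tB tHA =
    retract-of-terminal D tHA (H.F₁ (proj₁ (tA _))) (H.F₁ (proj₁ (tB _))) H-round-trip
    where
      H-round-trip : Category._∘_ D (H.F₁ (proj₁ (tB _))) (H.F₁ (proj₁ (tA _))) ≡ Category.id D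
      H-round-trip = trans (sym (H.F-∘ _ _))
        (trans (cong H.F₁ (terminal-hom-unique C tB _ _)) H.F-id)

module _ {o h t oc hc d op hp d'} {S : Model o h t} {𝒞 : Category oc hc}
         {F : Functor 𝒞 (Model.cat S)} {S• : DModel S 𝒞 F d}
         {fac : Factorization S• op hp d'} (sec : Section fac) where
  private
    module S = Model S
    module F = Functor F
    module fac = Factorization fac
    module sec = Section sec
    module S₀ = Functor sec.S₀
    module G = Functor fac.G
  open Inserter sec

  InsHom-≡ : ∀ {X Z} {f g : InsHom X Z} → mor f ≡ mor g → f ≡ g
  InsHom-≡ refl = refl

  S₀-preserves-terminal : ∀ {Γ} → IsTerminal S.cat Γ → IsTerminal fac.𝒫 (S₀.F₀ Γ)
  S₀-preserves-terminal tΓ =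
    terminal-image-transport sec.S₀ S.◇-terminal tΓ sec.S₀-◇

  GS₀-preserves-terminal : ∀ {Γ} → IsTerminal S.cat Γ → IsTerminal S.cat (G.F₀ (S₀.F₀ Γ))
  GS₀-preserves-terminal {Γ} tΓ =
    retract-of-terminal S.cat tΓ (sec.θ Γ) (sec.θ⁻¹ Γ) (sec.θ⁻¹θ Γ)

  module _ (T : Terminal 𝒞) (tFT : IsTerminal S.cat (F.F₀ (proj₁ T))) where
    private
      tS₀FT : IsTerminal fac.𝒫 (S₀.F₀ (F.F₀ (proj₁ T)))
      tS₀FT = S₀-preserves-terminal tFT

    terminalInsOb : InsOb
    terminalInsOb = insOb (proj₁ T) (proj₁ (tS₀FT _))
      (terminal-hom-unique S.cat (GS₀-preserves-terminal tFT) _ _)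

    terminalInsOb-isTerminal : IsTerminal ℐ terminalInsOb
    terminalInsOb-isTerminal X =
      insHom (proj₁ (proj₂ T (ob X))) (terminal-hom-unique fac.𝒫 tS₀FT _ _) ,
      λ g → InsHom-≡ (proj₂ (proj₂ T (ob X)) (mor g))

proposition34 : ∀ {o h t oc hc d op hp d'}
    (S : Model o h t) (𝒞 : Category oc hc) (F : Functor 𝒞 (Model.cat S))
    (S• : DModel S 𝒞 F d) (fac : Factorization S• op hp d') (sec : Section fac) →
    (T : Terminal 𝒞) → IsTerminal (Model.cat S) (Functor.F₀ F (proj₁ T)) →
    Σ (Terminal (Inserter.ℐ sec))
      (λ T' → IsTerminal 𝒞 (Functor.F₀ (Inserter.I sec) (proj₁ T')))
proposition34 S 𝒞 F S• fac sec T tFT =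
  (terminalInsOb sec T tFT , terminalInsOb-isTerminal sec T tFT) , proj₂ T
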